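{- Let ${\cal F}$ be a Fano plane, $\epsilon$ a composition factor on ${\cal F}$ and $g\in\mathrm{Aut}({\cal F})$. Then $\prod_{D\in{\cal F}^\ast}\delta^\ast(g,D)=1$.
   Context: ${\cal F}$ is a Fano plane (seven points, seven lines), ${\cal F}^\ast$ its set of lines, $\mathrm{Aut}({\cal F})$ the group of bijections sending lines to lines; for distinct $P,Q$, $P+Q$ is the third point on their line. $\mathbb F$ is a field of characteristic not 2 and $\mathbb O_{\cal F}$ has basis $1,e_P$ ($P\in{\cal F}$). A multiplication factor $\epsilon$ assigns $\epsilon_{PQ}\in\{\pm1\}$ to distinct $P,Q$ with $\epsilon_{QP}=-\epsilon_{PQ}$, defining the product with unit $1$, $e_Pe_Q=\epsilon_{PQ}e_{P+Q}$, $e_P^2=-1$; it is a composition factor if $N(\lambda^01+\sum\lambda^Pe_P)=(\lambda^0)^2+\sum(\lambda^P)^2$ satisfies $N(ZW)=N(Z)N(W)$. For a line $D$, $\delta^\ast(g,D)=\epsilon_{PQ}\epsilon_{g(P)g(Q)}$ for any two distinct $P,Q\in D$ (independent of the choice). -}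

module Defs where

open import Level using (Level; _⊔_)
import Data.Nat
open import Data.Bool using (Bool; true; false; _xor_)
open import Data.Fin using (Fin; zero; suc)
open import Data.Fin.Properties using () renaming (_≟_ to _≟ᶠ_)
open import Data.Maybe using (Maybe; nothing; just)
open import Data.Product using (Σ; _×_; _,_; ∃)
open import Data.List using (List; []; _∷_; foldr; map)
open import Data.Sign using (Sign; opposite) renaming (_*_ to _*ˢ_)
import Data.Sign as Sign
open import Relation.Nullary using (¬_; yes; no)
open import Relation.Binary.PropositionalEquality using (_≡_; _≢_)
open import Function using (Inverseᵇ)
open import Algebra.Bundles using (CommutativeRing)

-- Points: the seven nonzero vectors of F₂³.  Point i : Fin 7 encodes the
-- number (toℕ i + 1) ∈ {1,…,7} written in binary (b₂ b₁ b₀).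
-- The lines are the triples {P, Q, P+Q} where P+Q is the bitwise xor.

Point : Set
Point = Fin 7

bits : Point → Bool × Bool × Bool          -- (b₂ , b₁ , b₀)
bits zero                               = false , false , true
bits (suc zero)                         = false , true  , false
bits (suc (suc zero))                   = false , true  , true
bits (suc (suc (suc zero)))             = true  , false , false
bits (suc (suc (suc (suc zero))))       = true  , false , true
bits (suc (suc (suc (suc (suc zero))))) = true  , true  , false
bits (suc (suc (suc (suc (suc (suc zero)))))) = true , true , true

-- inverse of bits on nonzero vectors (the zero vector is never used:
-- it only arises for P + P, which is never needed)
fromBits : Bool × Bool × Bool → Point
fromBits (false , false , false) = zero
fromBits (false , false , true ) = zero
fromBits (false , true  , false) = suc zero
fromBits (false , true  , true ) = suc (suc zero)
fromBits (true  , false , false) = suc (suc (suc zero))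
fromBits (true  , false , true ) = suc (suc (suc (suc zero)))
fromBits (true  , true  , false) = suc (suc (suc (suc (suc zero))))
fromBits (true  , true  , true ) = suc (suc (suc (suc (suc (suc zero)))))

infixl 6 _⊕_
_⊕_ : Point → Point → Point
P ⊕ Q with bits P | bits Q
... | (a , b , c) | (a' , b' , c') = fromBits (a xor a' , b xor b' , c xor c')

record Line : Set where
  constructor ⟨_,_,_⟩
  field
    p₁ p₂ p₃ : Point

lines : List Line
lines =
    ⟨ pt 1 , pt 2 , pt 3 ⟩
  ∷ ⟨ pt 1 , pt 4 , pt 5 ⟩
  ∷ ⟨ pt 1 , pt 6 , pt 7 ⟩
  ∷ ⟨ pt 2 , pt 4 , pt 6 ⟩
  ∷ ⟨ pt 2 , pt 5 , pt 7 ⟩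
  ∷ ⟨ pt 3 , pt 4 , pt 7 ⟩
  ∷ ⟨ pt 3 , pt 5 , pt 6 ⟩
  ∷ []
  where
  pt : Data.Nat.ℕ → Point
  pt 2 = suc zero
  pt 3 = suc (suc zero)
  pt 4 = suc (suc (suc zero))
  pt 5 = suc (suc (suc (suc zero)))
  pt 6 = suc (suc (suc (suc (suc zero))))
  pt 7 = suc (suc (suc (suc (suc (suc zero)))))
  pt _ = zero   -- pt 1 (other arguments unused)

-- Aut(F): bijections of the points sending lines to lines.  The image of
-- the line {P, Q, P+Q} is a line iff it is the line {g P, g Q, g P + g Q},
-- i.e. iff g (P + Q) = g P + g Q.
record IsAut (g : Point → Point) : Set where
  field
    ginv       : Point → Point
    bijective  : Inverseᵇ _≡_ _≡_ g ginv
    lines→lines : ∀ P Q → P ≢ Q → g (P ⊕ Q) ≡ g P ⊕ g Q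

MultFactor : Set
MultFactor = Point → Point → Sign

IsMultFactor : MultFactor → Set
IsMultFactor ε = ∀ P Q → P ≢ Q → ε Q P ≡ opposite (ε P Q)

module _ {c ℓ : Level} (R : CommutativeRing c ℓ) where
  open CommutativeRing R hiding (zero)

  record IsField : Set (c ⊔ ℓ) where
    field
      1≉0     : ¬ (1# ≈ 0#)
      inverse : ∀ x → ¬ (x ≈ 0#) → ∃ λ y → x * y ≈ 1#

  CharNot2 : Set ℓ
  CharNot2 = ¬ (1# + 1# ≈ 0#)

  ∑ : ∀ {n} → (Fin n → Carrier) → Carrier
  ∑ {Data.Nat.zero} f = 0#
  ∑ {Data.Nat.suc n} f = f zero + ∑ (λ i → f (suc i))

  -- The algebra O_F: basis 1 (index nothing) and e_P (index just P).
  O : Set c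
  O = Maybe Point → Carrier

  ∑O : (Maybe Point → Carrier) → Carrier
  ∑O f = f nothing + ∑ (λ P → f (just P))

  sign : Sign → Carrier
  sign Sign.+ = 1#
  sign Sign.- = - 1#

  unit : Maybe Point → O
  unit nothing  nothing  = 1#
  unit nothing  (just _) = 0#
  unit (just P) nothing  = 0#
  unit (just P) (just Q) with P ≟ᶠ Q
  ... | yes _ = 1#
  ... | no  _ = 0#

  basisMul : MultFactor → Maybe Point → Maybe Point → O
  basisMul ε nothing  j        = unit j
  basisMul ε (just P) nothing  = unit (just P)
  basisMul ε (just P) (just Q) k with P ≟ᶠ Q
  ... | yes _ = - unit nothing k
  ... | no  _ = sign (ε P Q) * unit (just (P ⊕ Q)) k

  mul : MultFactor → O → O → O
  mul ε Z W k = ∑O (λ i → ∑O (λ j → (Z i * W j) * basisMul ε i j k))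

  N : O → Carrier
  N Z = ∑O (λ i → Z i * Z i)

  IsCompositionFactor : MultFactor → Set (c ⊔ ℓ)
  IsCompositionFactor ε =
    IsMultFactor ε × (∀ Z W → N (mul ε Z W) ≈ N Z * N W)

-- δ*(g, D) = ε_{PQ} ε_{g(P) g(Q)} for two distinct points P, Q of D
-- (we use the first two listed points of D).

δ* : MultFactor → (Point → Point) → Line → Sign
δ* ε g ⟨ P , Q , _ ⟩ = ε P Q *ˢ ε (g P) (g Q)

∏δ* : MultFactor → (Point → Point) → Sign
∏δ* ε g = foldr _*ˢ_ Sign.+ (map (δ* ε g) lines)

module Submission where

-- Taking Z = 1 + e_A and W = e_B + e_C with C = A + B gives ZW = (1 + ε_{AC}) e_B + (1 + ε_{AB}) e_C,
-- so N(ZW) = N(Z) N(W) = 4 is only possible (in characteristic not 2) if ε_{A,A+B} = -ε_{AB}.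
-- With antisymmetry this makes ε invariant under the rotation (P, Q) ↦ (Q, P + Q) of the ordered
-- pairs of a line, so ε_{PQ} = ±σ_D, where σ_D is the value of ε on a reference pair of the line D
-- through P and Q and the sign says whether (P, Q) runs along or against the cyclic order of D.
-- Hence ∏_D δ*(g, D) is the value of a formal signed monomial in the seven σ_D. An automorphism is
-- determined by the images of the points 1, 2 and 4, and for each of the 168 possible images that
-- monomial computes to 1.

open import Defs
open import Level using (Level)
open import Algebra.Bundles using (CommutativeRing)
open import Data.Bool using (Bool; true; false; if_then_else_; _xor_)
import Data.Bool.Properties as Boolₚ
open import Data.Empty using (⊥-elim)
open import Data.Fin using (Fin; zero; suc; punchIn)
open import Data.Fin.Patterns using (0F; 1F; 2F; 3F; 4F; 5F; 6F)
open import Data.Fin.Properties using (all?; any?; punchInᵢ≢i) renaming (_≟_ to _≟ᶠ_)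
open import Data.List using ([]; _∷_; foldr; map; lookup)
open import Data.List.Properties using (map-cong; map-cong-local; map-∘)
open import Data.List.Relation.Unary.All as All using (All)
open import Data.List.Membership.Propositional.Properties using (∈-lookup)
open import Data.Maybe using (Maybe; nothing; just)
open import Data.Maybe.Properties using (just-injective)
open import Data.Nat as ℕ using (ℕ)
open import Data.Product using (_×_; _,_; proj₁; proj₂; ∃-syntax; uncurry)
open import Data.Product.Properties using (≡-dec)
open import Data.Sign using (Sign; opposite) renaming (_*_ to _*ˢ_)
import Data.Sign as Sign
import Data.Sign.Properties as Signₚ
open import Data.Sum using (_⊎_; inj₁; inj₂; [_,_]′)
open import Data.Vec using (Vec; []; _∷_; replicate; zipWith; tabulate)
import Data.Vec as Vec
import Data.Vec.Properties as Vecₚ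
open import Data.Vec.Functional using (Vector)
open import Function using (_∘_; Injective)
open import Function.Consequences.Propositional using (inverseʳ⇒injective)
open import Relation.Nullary using (¬_; Dec; yes; no; ¬?; _⊎-dec_; _×-dec_; _→-dec_; contradiction)
open import Relation.Nullary.Decidable using (from-yes)
open import Relation.Binary.PropositionalEquality
  using (_≡_; _≢_; _≗_; refl; sym; trans; cong; cong₂; module ≡-Reasoning)
open import Algebra.Properties.CommutativeSemigroup Signₚ.*-commutativeSemigroup
  using () renaming (interchange to *ˢ-interchange)

Monomial : ℕ → Set
Monomial n = Sign × Vec Bool n

_·_ : ∀ {n} → Monomial n → Monomial n → Monomial n
(s , v) · (t , w) = s *ˢ t , zipWith _xor_ v w

1ᴹ : ∀ {n} → Monomial n
1ᴹ = Sign.+ , replicate _ false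

_≟ᴹ_ : ∀ {n} (m m′ : Monomial n) → Dec (m ≡ m′)
_≟ᴹ_ = ≡-dec Signₚ._≟_ (Vecₚ.≡-dec Boolₚ._≟_)

indicator : ∀ {n} → Fin n → Vec Bool n
indicator zero    = true ∷ replicate _ false
indicator (suc i) = false ∷ indicator i

selectProduct : ∀ {n} → Vec Sign n → Vec Bool n → Sign
selectProduct []      []      = Sign.+
selectProduct (s ∷ σ) (b ∷ v) = (if b then s else Sign.+) *ˢ selectProduct σ v

evalᴹ : ∀ {n} → Vec Sign n → Monomial n → Sign
evalᴹ σ (s , v) = s *ˢ selectProduct σ v

select-xor : ∀ s b c → (if b xor c then s else Sign.+) ≡ (if b then s else Sign.+) *ˢ (if c then s else Sign.+)
select-xor s false c     = refl
select-xor s true  false = sym (Signₚ.*-identityʳ s)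
select-xor s true  true  = sym (Signₚ.s*s≡+ s)

selectProduct-xor : ∀ {n} (σ : Vec Sign n) v w →
  selectProduct σ (zipWith _xor_ v w) ≡ selectProduct σ v *ˢ selectProduct σ w
selectProduct-xor []      []      []      = refl
selectProduct-xor (s ∷ σ) (b ∷ v) (c ∷ w) =
  trans (cong₂ _*ˢ_ (select-xor s b c) (selectProduct-xor σ v w))
        (*ˢ-interchange (if b then s else Sign.+) (if c then s else Sign.+) (selectProduct σ v) (selectProduct σ w))

selectProduct-none : ∀ {n} (σ : Vec Sign n) → selectProduct σ (replicate _ false) ≡ Sign.+
selectProduct-none []      = refl
selectProduct-none (s ∷ σ) = selectProduct-none σ

selectProduct-indicator : ∀ {n} (σ : Vec Sign n) i → selectProduct σ (indicator i) ≡ Vec.lookup σ i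
selectProduct-indicator (s ∷ σ) zero    = trans (cong (s *ˢ_) (selectProduct-none σ)) (Signₚ.*-identityʳ s)
selectProduct-indicator (s ∷ σ) (suc i) = selectProduct-indicator σ i

evalᴹ-· : ∀ {n} (σ : Vec Sign n) m m′ → evalᴹ σ (m · m′) ≡ evalᴹ σ m *ˢ evalᴹ σ m′
evalᴹ-· σ (s , v) (t , w) =
  trans (cong (s *ˢ t *ˢ_) (selectProduct-xor σ v w)) (*ˢ-interchange s t _ _)

evalᴹ-1 : ∀ {n} (σ : Vec Sign n) → evalᴹ σ 1ᴹ ≡ Sign.+
evalᴹ-1 = selectProduct-none

evalᴹ-foldr : ∀ {n} (σ : Vec Sign n) ms →
  evalᴹ σ (foldr _·_ 1ᴹ ms) ≡ foldr _*ˢ_ Sign.+ (map (evalᴹ σ) ms)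
evalᴹ-foldr σ []       = evalᴹ-1 σ
evalᴹ-foldr σ (m ∷ ms) = trans (evalᴹ-· σ m _) (cong (evalᴹ σ m *ˢ_) (evalᴹ-foldr σ ms))

⊕-comm : ∀ P Q → P ⊕ Q ≡ Q ⊕ P
⊕-comm = from-yes (all? λ P → all? λ Q → P ⊕ Q ≟ᶠ Q ⊕ P)

⊕-cancelˡ : ∀ P Q → P ≢ Q → P ⊕ (P ⊕ Q) ≡ Q
⊕-cancelˡ = from-yes (all? λ P → all? λ Q → ¬? (P ≟ᶠ Q) →-dec P ⊕ (P ⊕ Q) ≟ᶠ Q)

≢-⊕ˡ : ∀ P Q → P ≢ Q → P ≢ P ⊕ Q
≢-⊕ˡ = from-yes (all? λ P → all? λ Q → ¬? (P ≟ᶠ Q) →-dec ¬? (P ≟ᶠ P ⊕ Q))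

≢-⊕ʳ : ∀ P Q → P ≢ Q → Q ≢ P ⊕ Q
≢-⊕ʳ = from-yes (all? λ P → all? λ Q → ¬? (P ≟ᶠ Q) →-dec ¬? (Q ≟ᶠ P ⊕ Q))

lines-distinct : All (λ D → Line.p₁ D ≢ Line.p₂ D) lines
lines-distinct = from-yes (All.all? (λ D → ¬? (Line.p₁ D ≟ᶠ Line.p₂ D)) lines)

line : Fin 7 → Line
line = lookup lines

refPair : Fin 7 → Point × Point
refPair i = Line.p₁ (line i) , Line.p₂ (line i)

refPair-distinct : ∀ i → Line.p₁ (line i) ≢ Line.p₂ (line i)
refPair-distinct i = All.lookup lines-distinct (∈-lookup i)

rotate : Point × Point → Point × Point
rotate (P , Q) = Q , P ⊕ Q

_∈⟳_ : Point × Point → Point × Point → Set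
pq ∈⟳ xy = pq ≡ xy ⊎ pq ≡ rotate xy ⊎ pq ≡ rotate (rotate xy)

_≟²_ : (pq rs : Point × Point) → Dec (pq ≡ rs)
_≟²_ = ≡-dec _≟ᶠ_ _≟ᶠ_

_∈⟳?_ : ∀ pq xy → Dec (pq ∈⟳ xy)
pq ∈⟳? xy = pq ≟² xy ⊎-dec pq ≟² rotate xy ⊎-dec pq ≟² rotate (rotate xy)

onSomeLine? : ∀ pq → Dec (∃[ i ] pq ∈⟳ refPair i)
onSomeLine? pq = any? (λ i → pq ∈⟳? refPair i)

∈⟳-total : ∀ P Q → P ≢ Q → ∃[ i ] (P , Q) ∈⟳ refPair i ⊎ ∃[ i ] (Q , P) ∈⟳ refPair i
∈⟳-total = from-yes (all? λ P → all? λ Q → ¬? (P ≟ᶠ Q) →-dec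
  (onSomeLine? (P , Q) ⊎-dec onSomeLine? (Q , P)))

-- The variable of the line through P and Q, with sign + if (P, Q) lies in the rotation orbit of
-- the line's reference pair and - if (Q, P) does; the last clause is only reached when P ≡ Q.
signedLine : ∀ {P Q} → Dec (∃[ i ] (P , Q) ∈⟳ refPair i) → Dec (∃[ i ] (Q , P) ∈⟳ refPair i) → Monomial 7
signedLine (yes (i , _)) _             = Sign.+ , indicator i
signedLine (no _)        (yes (i , _)) = Sign.- , indicator i
signedLine (no _)        (no _)        = 1ᴹ

lineMonomial : Point → Point → Monomial 7
lineMonomial P Q = signedLine (onSomeLine? (P , Q)) (onSomeLine? (Q , P))

Cyclic : MultFactor → Set
Cyclic ε = ∀ P Q → P ≢ Q → ε Q (P ⊕ Q) ≡ ε P Q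

flip⇒cyclic : ∀ {ε} → IsMultFactor ε → (∀ A B → A ≢ B → ε A (A ⊕ B) ≡ opposite (ε A B)) → Cyclic ε
flip⇒cyclic {ε} anti flip P Q P≢Q = begin
  ε Q (P ⊕ Q)                 ≡⟨ cong (ε Q) (⊕-comm P Q) ⟩
  ε Q (Q ⊕ P)                 ≡⟨ flip Q P (P≢Q ∘ sym) ⟩
  opposite (ε Q P)            ≡⟨ cong opposite (anti P Q P≢Q) ⟩
  opposite (opposite (ε P Q)) ≡⟨ Signₚ.opposite-involutive (ε P Q) ⟩
  ε P Q                       ∎
  where open ≡-Reasoning

cyclic-∈⟳ : ∀ {ε} → Cyclic ε → ∀ {pq} xy → proj₁ xy ≢ proj₂ xy → pq ∈⟳ xy → uncurry ε pq ≡ uncurry ε xy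
cyclic-∈⟳ cyc xy       X≢Y (inj₁ refl)        = refl
cyclic-∈⟳ cyc (X , Y) X≢Y (inj₂ (inj₁ refl)) = cyc X Y X≢Y
cyclic-∈⟳ cyc (X , Y) X≢Y (inj₂ (inj₂ refl)) = trans (cyc Y (X ⊕ Y) (≢-⊕ʳ X Y X≢Y)) (cyc X Y X≢Y)

orientationOf : MultFactor → Vec Sign 7
orientationOf ε = tabulate (uncurry ε ∘ refPair)

selectProduct-orientationOf : ∀ ε i → selectProduct (orientationOf ε) (indicator i) ≡ uncurry ε (refPair i)
selectProduct-orientationOf ε i =
  trans (selectProduct-indicator (orientationOf ε) i) (Vecₚ.lookup∘tabulate (uncurry ε ∘ refPair) i)

cyclic⇒lineMonomial : ∀ {ε} → IsMultFactor ε → Cyclic ε →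
  ∀ P Q → P ≢ Q → ε P Q ≡ evalᴹ (orientationOf ε) (lineMonomial P Q)
cyclic⇒lineMonomial {ε} anti cyc P Q P≢Q = signedLine-correct (onSomeLine? (P , Q)) (onSomeLine? (Q , P))
  where
  onLine : ∀ {pq} i → pq ∈⟳ refPair i → uncurry ε pq ≡ selectProduct (orientationOf ε) (indicator i)
  onLine i pq∈i = trans (cyclic-∈⟳ cyc (refPair i) (refPair-distinct i) pq∈i) (sym (selectProduct-orientationOf ε i))
  signedLine-correct : ∀ d d′ → ε P Q ≡ evalᴹ (orientationOf ε) (signedLine {P} {Q} d d′)
  signedLine-correct (yes (i , PQ∈i)) _ = onLine i PQ∈i
  signedLine-correct (no _) (yes (i , QP∈i)) = trans (anti Q P (P≢Q ∘ sym)) (cong opposite (onLine i QP∈i))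
  signedLine-correct (no ¬PQ) (no ¬QP) = ⊥-elim ([ ¬PQ , ¬QP ]′ (∈⟳-total P Q P≢Q))

δ*ᴹ : (Point → Point) → Line → Monomial 7
δ*ᴹ g ⟨ P , Q , _ ⟩ = lineMonomial P Q · lineMonomial (g P) (g Q)

∏δ*ᴹ : (Point → Point) → Monomial 7
∏δ*ᴹ g = foldr _·_ 1ᴹ (map (δ*ᴹ g) lines)

∏δ*≡evalᴹ : ∀ {ε g} σ → (∀ P Q → P ≢ Q → ε P Q ≡ evalᴹ σ (lineMonomial P Q)) →
  Injective _≡_ _≡_ g → ∏δ* ε g ≡ evalᴹ σ (∏δ*ᴹ g)
∏δ*≡evalᴹ {ε} {g} σ ε≡ g-injective = begin
  foldr _*ˢ_ Sign.+ (map (δ* ε g) lines)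
    ≡⟨ cong (foldr _*ˢ_ Sign.+) (map-cong-local (All.map (λ {D} → δ*≡evalᴹ {D}) lines-distinct)) ⟩
  foldr _*ˢ_ Sign.+ (map (evalᴹ σ ∘ δ*ᴹ g) lines)
    ≡⟨ cong (foldr _*ˢ_ Sign.+) (map-∘ {g = evalᴹ σ} {f = δ*ᴹ g} lines) ⟩
  foldr _*ˢ_ Sign.+ (map (evalᴹ σ) (map (δ*ᴹ g) lines))
    ≡⟨ evalᴹ-foldr σ (map (δ*ᴹ g) lines) ⟨
  evalᴹ σ (∏δ*ᴹ g) ∎
  where
  open ≡-Reasoning
  δ*≡evalᴹ : ∀ {D} → Line.p₁ D ≢ Line.p₂ D → δ* ε g D ≡ evalᴹ σ (δ*ᴹ g D)
  δ*≡evalᴹ {⟨ P , Q , _ ⟩} P≢Q =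
    trans (cong₂ _*ˢ_ (ε≡ P Q P≢Q) (ε≡ (g P) (g Q) (P≢Q ∘ g-injective)))
          (sym (evalᴹ-· σ (lineMonomial P Q) (lineMonomial (g P) (g Q))))

∏δ*ᴹ-cong : ∀ {g h} → g ≗ h → ∏δ*ᴹ g ≡ ∏δ*ᴹ h
∏δ*ᴹ-cong {g} {h} g≗h = cong (foldr _·_ 1ᴹ) (map-cong δ*ᴹ-cong lines)
  where
  δ*ᴹ-cong : ∀ D → δ*ᴹ g D ≡ δ*ᴹ h D
  δ*ᴹ-cong ⟨ P , Q , _ ⟩ = cong₂ (λ x y → lineMonomial P Q · lineMonomial x y) (g≗h P) (g≗h Q)

-- The F₂-linear map sending the points 1, 2, 4 (that is 0F, 1F, 3F) to a, b, c.
frameMap : Point → Point → Point → Point → Point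
frameMap a b c 0F = a
frameMap a b c 1F = b
frameMap a b c 2F = a ⊕ b
frameMap a b c 3F = c
frameMap a b c 4F = a ⊕ c
frameMap a b c 5F = b ⊕ c
frameMap a b c 6F = a ⊕ (b ⊕ c)

IsFrame : Point → Point → Point → Set
IsFrame a b c = a ≢ b × a ≢ c × b ≢ c × c ≢ a ⊕ b

isFrame? : ∀ a b c → Dec (IsFrame a b c)
isFrame? a b c = ¬? (a ≟ᶠ b) ×-dec ¬? (a ≟ᶠ c) ×-dec ¬? (b ≟ᶠ c) ×-dec ¬? (c ≟ᶠ a ⊕ b)

∏δ*ᴹ-frameMap : ∀ a b c → IsFrame a b c → ∏δ*ᴹ (frameMap a b c) ≡ 1ᴹ
∏δ*ᴹ-frameMap = from-yes (all? λ a → all? λ b → all? λ c →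
  isFrame? a b c →-dec ∏δ*ᴹ (frameMap a b c) ≟ᴹ 1ᴹ)

module _ {g} (aut : IsAut g) where
  open IsAut aut

  aut-injective : Injective _≡_ _≡_ g
  aut-injective = inverseʳ⇒injective g (proj₂ bijective)

  aut≗frameMap : g ≗ frameMap (g 0F) (g 1F) (g 3F)
  aut≗frameMap 0F = refl
  aut≗frameMap 1F = refl
  aut≗frameMap 2F = lines→lines 0F 1F λ ()
  aut≗frameMap 3F = refl
  aut≗frameMap 4F = lines→lines 0F 3F λ ()
  aut≗frameMap 5F = lines→lines 1F 3F λ ()
  aut≗frameMap 6F = trans (lines→lines 0F 5F λ ()) (cong (g 0F ⊕_) (aut≗frameMap 5F))

  aut-isFrame : IsFrame (g 0F) (g 1F) (g 3F)
  aut-isFrame = (λ ()) ∘ aut-injective , (λ ()) ∘ aut-injective , (λ ()) ∘ aut-injective ,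
                (λ ()) ∘ aut-injective ∘ (λ e → trans e (sym (aut≗frameMap 2F)))

  ∏δ*ᴹ-aut : ∏δ*ᴹ g ≡ 1ᴹ
  ∏δ*ᴹ-aut = trans (∏δ*ᴹ-cong aut≗frameMap) (∏δ*ᴹ-frameMap _ _ _ aut-isFrame)

module Composition {c ℓ : Level} (R : CommutativeRing c ℓ) where
  open CommutativeRing R
    renaming (refl to ≈-refl; sym to ≈-sym; trans to ≈-trans) hiding (zero)
  open import Algebra.Properties.Semiring.Sum semiring
    using (sum; sum-cong-≋; sum-replicate-zero; sum-remove; ∑-distrib-+)
  open import Algebra.Properties.CommutativeSemigroup +-commutativeSemigroup
    using () renaming (interchange to +-interchange)
  open import Algebra.Properties.CommutativeSemigroup *-commutativeSemigroup
    using (xy∙z≈y∙xz)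
  open import Algebra.Properties.Group +-group using (identityʳ-unique)
  open import Relation.Binary.Reasoning.Setoid setoid

  two : Carrier
  two = 1# + 1#

  sum-zero : ∀ {n} (f : Vector Carrier n) → (∀ i → f i ≈ 0#) → sum f ≈ 0#
  sum-zero {n} f f≈0 = ≈-trans (sum-cong-≋ f≈0) (sum-replicate-zero n)

  sum-single : ∀ {n} (f : Vector Carrier (ℕ.suc n)) q → (∀ i → i ≢ q → f i ≈ 0#) → sum f ≈ f q
  sum-single f q f≈0 = begin
    sum f                     ≈⟨ sum-remove f ⟩
    f q + sum (f ∘ punchIn q) ≈⟨ +-congˡ (sum-zero _ (λ j → f≈0 _ (punchInᵢ≢i q j))) ⟩
    f q + 0#                  ≈⟨ +-identityʳ _ ⟩
    f q                       ∎

  ∑O-cong : ∀ {f g : Maybe Point → Carrier} → (∀ i → f i ≈ g i) → ∑O R f ≈ ∑O R g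
  ∑O-cong f≈g = +-cong (f≈g nothing) (sum-cong-≋ (f≈g ∘ just))

  ∑O-distrib-+ : ∀ (f g : Maybe Point → Carrier) → ∑O R (λ i → f i + g i) ≈ ∑O R f + ∑O R g
  ∑O-distrib-+ f g = ≈-trans (+-congˡ (∑-distrib-+ (f ∘ just) (g ∘ just))) (+-interchange _ _ _ _)

  ∑O-single : ∀ (f : Maybe Point → Carrier) a → (∀ i → i ≢ a → f i ≈ 0#) → ∑O R f ≈ f a
  ∑O-single f nothing f≈0 = ≈-trans (+-congˡ (sum-zero (f ∘ just) (λ i → f≈0 (just i) λ ()))) (+-identityʳ _)
  ∑O-single f (just Q) f≈0 = ≈-trans
    (+-cong (f≈0 nothing λ ()) (sum-single (f ∘ just) Q (λ i i≢Q → f≈0 (just i) (i≢Q ∘ just-injective))))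
    (+-identityˡ _)

  unit-diag : ∀ a → unit R a a ≈ 1#
  unit-diag nothing = ≈-refl
  unit-diag (just P) with P ≟ᶠ P
  ... | yes _   = ≈-refl
  ... | no P≢P = contradiction refl P≢P

  unit-off : ∀ a i → i ≢ a → unit R a i ≈ 0#
  unit-off nothing  nothing  i≢a = contradiction refl i≢a
  unit-off nothing  (just _) _   = ≈-refl
  unit-off (just _) nothing  _   = ≈-refl
  unit-off (just P) (just Q) Q≢P with P ≟ᶠ Q
  ... | yes P≡Q = contradiction (cong just (sym P≡Q)) Q≢P
  ... | no _    = ≈-refl

  ∑O-unit : ∀ a (f : Maybe Point → Carrier) → ∑O R (λ i → unit R a i * f i) ≈ f a
  ∑O-unit a f = begin
    ∑O R (λ i → unit R a i * f i)
      ≈⟨ ∑O-single (λ i → unit R a i * f i) a (λ i i≢a → ≈-trans (*-congʳ (unit-off a i i≢a)) (zeroˡ _)) ⟩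
    unit R a a * f a              ≈⟨ *-congʳ (unit-diag a) ⟩
    1# * f a                      ≈⟨ *-identityˡ _ ⟩
    f a                           ∎

  ∑O-unit₂ : ∀ a b (f : Maybe Point → Carrier) → ∑O R (λ i → (unit R a i + unit R b i) * f i) ≈ f a + f b
  ∑O-unit₂ a b f = begin
    ∑O R (λ i → (unit R a i + unit R b i) * f i)
      ≈⟨ ∑O-cong (λ i → distribʳ (f i) (unit R a i) (unit R b i)) ⟩
    ∑O R (λ i → unit R a i * f i + unit R b i * f i)
      ≈⟨ ∑O-distrib-+ (λ i → unit R a i * f i) (λ i → unit R b i * f i) ⟩
    ∑O R (λ i → unit R a i * f i) + ∑O R (λ i → unit R b i * f i)
      ≈⟨ +-cong (∑O-unit a f) (∑O-unit b f) ⟩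
    f a + f b ∎

  ∑O-scaled : ∀ α a (f : Maybe Point → Carrier) → ∑O R (λ i → α * unit R a i * f i) ≈ α * f a
  ∑O-scaled α a f = ≈-trans (∑O-cong (λ i → xy∙z≈y∙xz α (unit R a i) (f i))) (∑O-unit a (λ i → α * f i))

  mul-unit₂ : ∀ ε a b c d k →
    mul R ε (λ i → unit R a i + unit R b i) (λ j → unit R c j + unit R d j) k
      ≈ (basisMul R ε a c k + basisMul R ε a d k) + (basisMul R ε b c k + basisMul R ε b d k)
  mul-unit₂ ε a b c d k = begin
    ∑O R (λ i → ∑O R (λ j → Z i * W j * M i j)) ≈⟨ ∑O-cong inner ⟩
    ∑O R (λ i → Z i * (M i c + M i d))          ≈⟨ ∑O-unit₂ a b (λ i → M i c + M i d) ⟩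
    (M a c + M a d) + (M b c + M b d)           ∎
    where
    Z W : O R
    Z i = unit R a i + unit R b i
    W j = unit R c j + unit R d j
    M : Maybe Point → Maybe Point → Carrier
    M i j = basisMul R ε i j k
    inner : ∀ i → ∑O R (λ j → Z i * W j * M i j) ≈ Z i * (M i c + M i d)
    inner i = begin
      ∑O R (λ j → Z i * W j * M i j)   ≈⟨ ∑O-cong (λ j → xy∙z≈y∙xz (Z i) (W j) (M i j)) ⟩
      ∑O R (λ j → W j * (Z i * M i j)) ≈⟨ ∑O-unit₂ c d (λ j → Z i * M i j) ⟩
      Z i * M i c + Z i * M i d        ≈⟨ distribˡ (Z i) (M i c) (M i d) ⟨
      Z i * (M i c + M i d)            ∎

  basisMul-≢ : ∀ ε {P Q} k → P ≢ Q → basisMul R ε (just P) (just Q) k ≈ sign R (ε P Q) * unit R (just (P ⊕ Q)) k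
  basisMul-≢ ε {P} {Q} k P≢Q with P ≟ᶠ Q
  ... | yes P≡Q = contradiction P≡Q P≢Q
  ... | no _    = ≈-refl

  N-cong : ∀ {Z Z′ : O R} → (∀ k → Z k ≈ Z′ k) → N R Z ≈ N R Z′
  N-cong Z≈Z′ = ∑O-cong (λ k → *-cong (Z≈Z′ k) (Z≈Z′ k))

  N-unit₂ : ∀ {a b} → a ≢ b → N R (λ k → unit R a k + unit R b k) ≈ two
  N-unit₂ {a} {b} a≢b = begin
    N R (λ k → unit R a k + unit R b k) ≈⟨ ∑O-unit₂ a b (λ k → unit R a k + unit R b k) ⟩
    (unit R a a + unit R b a) + (unit R a b + unit R b b)
      ≈⟨ +-cong (+-cong (unit-diag a) (unit-off b a a≢b)) (+-cong (unit-off a b (a≢b ∘ sym)) (unit-diag b)) ⟩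
    (1# + 0#) + (0# + 1#)               ≈⟨ +-cong (+-identityʳ 1#) (+-identityˡ 1#) ⟩
    two                                 ∎

  N-pair : ∀ {a b} → a ≢ b → ∀ α β → N R (λ k → α * unit R a k + β * unit R b k) ≈ α * α + β * β
  N-pair {a} {b} a≢b α β = begin
    ∑O R (λ k → Z k * Z k)
      ≈⟨ ∑O-cong (λ k → distribʳ (Z k) (α * unit R a k) (β * unit R b k)) ⟩
    ∑O R (λ k → α * unit R a k * Z k + β * unit R b k * Z k)
      ≈⟨ ∑O-distrib-+ (λ k → α * unit R a k * Z k) (λ k → β * unit R b k * Z k) ⟩
    ∑O R (λ k → α * unit R a k * Z k) + ∑O R (λ k → β * unit R b k * Z k)
      ≈⟨ +-cong (∑O-scaled α a Z) (∑O-scaled β b Z) ⟩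
    α * Z a + β * Z b
      ≈⟨ +-cong (*-congˡ Z-a) (*-congˡ Z-b) ⟩
    α * α + β * β ∎
    where
    Z : O R
    Z k = α * unit R a k + β * unit R b k
    Z-a : Z a ≈ α
    Z-a = begin
      α * unit R a a + β * unit R b a ≈⟨ +-cong (*-congˡ (unit-diag a)) (*-congˡ (unit-off b a a≢b)) ⟩
      α * 1# + β * 0#                 ≈⟨ +-cong (*-identityʳ α) (zeroʳ β) ⟩
      α + 0#                          ≈⟨ +-identityʳ α ⟩
      α                               ∎
    Z-b : Z b ≈ β
    Z-b = begin
      α * unit R a b + β * unit R b b ≈⟨ +-cong (*-congˡ (unit-off a b (a≢b ∘ sym))) (*-congˡ (unit-diag b)) ⟩
      α * 0# + β * 1#                 ≈⟨ +-cong (zeroʳ α) (*-identityʳ β) ⟩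
      0# + β                          ≈⟨ +-identityˡ β ⟩
      β                               ∎

  collect-coefficients : ∀ x y p q → (x + y) + (p * y + q * x) ≈ (1# + q) * x + (1# + p) * y
  collect-coefficients x y p q = begin
    (x + y) + (p * y + q * x)           ≈⟨ +-congˡ (+-comm (p * y) (q * x)) ⟩
    (x + y) + (q * x + p * y)           ≈⟨ +-interchange x y (q * x) (p * y) ⟩
    (x + q * x) + (y + p * y)           ≈⟨ +-cong (+-congʳ (*-identityˡ x)) (+-congʳ (*-identityˡ y)) ⟨
    (1# * x + q * x) + (1# * y + p * y) ≈⟨ +-cong (distribʳ x 1# q) (distribʳ y 1# p) ⟨
    (1# + q) * x + (1# + p) * y         ∎

  *-nonzero : IsField R → ∀ {x y} → ¬ x ≈ 0# → ¬ y ≈ 0# → ¬ x * y ≈ 0#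
  *-nonzero isField {x} {y} x≉0 y≉0 xy≈0 with IsField.inverse isField x x≉0
  ... | x⁻¹ , xx⁻¹≈1 = y≉0 (begin
    y             ≈⟨ *-identityˡ y ⟨
    1# * y        ≈⟨ *-congʳ xx⁻¹≈1 ⟨
    x * x⁻¹ * y   ≈⟨ xy∙z≈y∙xz x x⁻¹ y ⟩
    x⁻¹ * (x * y) ≈⟨ *-congˡ xy≈0 ⟩
    x⁻¹ * 0#      ≈⟨ zeroʳ x⁻¹ ⟩
    0#            ∎)

  sign-sum-squares⇒opposite : IsField R → CharNot2 R → ∀ s t →
    (1# + sign R s) * (1# + sign R s) + (1# + sign R t) * (1# + sign R t) ≈ two * two → s ≡ opposite t
  sign-sum-squares⇒opposite isField char≢2 Sign.+ Sign.- _ = refl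
  sign-sum-squares⇒opposite isField char≢2 Sign.- Sign.+ _ = refl
  sign-sum-squares⇒opposite isField char≢2 Sign.+ Sign.+ 4+4≈4 =
    contradiction (identityʳ-unique (two * two) (two * two) 4+4≈4) (*-nonzero isField char≢2 char≢2)
  sign-sum-squares⇒opposite isField char≢2 Sign.- Sign.- 0+0≈4 =
    contradiction (≈-trans (≈-sym 0+0≈4) (≈-trans (+-cong 0² 0²) (+-identityʳ 0#))) (*-nonzero isField char≢2 char≢2)
    where
    0² : (1# + - 1#) * (1# + - 1#) ≈ 0#
    0² = ≈-trans (*-congʳ (-‿inverseʳ 1#)) (zeroˡ _)

  composition⇒flip : IsField R → CharNot2 R → ∀ {ε} → IsCompositionFactor R ε →
    ∀ A B → A ≢ B → ε A (A ⊕ B) ≡ opposite (ε A B)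
  composition⇒flip isField char≢2 {ε} (_ , N-mul) A B A≢B =
    sign-sum-squares⇒opposite isField char≢2 (ε A C) (ε A B) (begin
      (1# + sAC) * (1# + sAC) + (1# + sAB) * (1# + sAB) ≈⟨ N-pair B≢C _ _ ⟨
      N R (λ k → (1# + sAC) * e B k + (1# + sAB) * e C k) ≈⟨ N-cong ZW≈ ⟨
      N R (mul R ε Z W)                                   ≈⟨ N-mul Z W ⟩
      N R Z * N R W                                       ≈⟨ *-cong (N-unit₂ {nothing} {just A} λ ()) (N-unit₂ B≢C) ⟩
      two * two                                           ∎)
    where
    C : Point
    C = A ⊕ B
    B≢C : just B ≢ just C
    B≢C = ≢-⊕ʳ A B A≢B ∘ just-injective
    e : Point → O R
    e P = unit R (just P)
    sAB sAC : Carrier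
    sAB = sign R (ε A B)
    sAC = sign R (ε A C)
    Z W : O R
    Z i = unit R nothing i + e A i
    W j = e B j + e C j
    ZW≈ : ∀ k → mul R ε Z W k ≈ (1# + sAC) * e B k + (1# + sAB) * e C k
    ZW≈ k = begin
      mul R ε Z W k
        ≈⟨ mul-unit₂ ε nothing (just A) (just B) (just C) k ⟩
      (e B k + e C k) + (basisMul R ε (just A) (just B) k + basisMul R ε (just A) (just C) k)
        ≈⟨ +-congˡ (+-cong (basisMul-≢ ε k A≢B) (basisMul-≢ ε k (≢-⊕ˡ A B A≢B))) ⟩
      (e B k + e C k) + (sAB * e C k + sAC * e (A ⊕ C) k)
        ≡⟨ cong (λ P → (e B k + e C k) + (sAB * e C k + sAC * e P k)) (⊕-cancelˡ A B A≢B) ⟩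
      (e B k + e C k) + (sAB * e C k + sAC * e B k)
        ≈⟨ collect-coefficients (e B k) (e C k) sAB sAC ⟩
      (1# + sAC) * e B k + (1# + sAB) * e C k ∎

proposition2p27 : {c ℓ : Level} (𝔽 : CommutativeRing c ℓ) → IsField 𝔽 → CharNot2 𝔽
                    → (ε : MultFactor) → IsCompositionFactor 𝔽 ε
                    → (g : Point → Point) → IsAut g
                    → ∏δ* ε g ≡ Sign.+
proposition2p27 𝔽 isField char≢2 ε composition g aut = begin
  ∏δ* ε g          ≡⟨ ∏δ*≡evalᴹ σ (cyclic⇒lineMonomial anti cyclic) (aut-injective aut) ⟩
  evalᴹ σ (∏δ*ᴹ g) ≡⟨ cong (evalᴹ σ) (∏δ*ᴹ-aut aut) ⟩
  evalᴹ σ 1ᴹ       ≡⟨ evalᴹ-1 σ ⟩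
  Sign.+           ∎
  where
  open ≡-Reasoning
  anti : IsMultFactor ε
  anti = proj₁ composition
  cyclic : Cyclic ε
  cyclic = flip⇒cyclic anti (Composition.composition⇒flip 𝔽 isField char≢2 composition)
  σ : Vec Sign 7
  σ = orientationOf ε
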